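{- Let $R$ be a commutative ring with $1$ and let $(M,\operatorname{rk},m)$ be a ranked set with multiplicities. Then, as an identity in $R(x,y)$, \[ \mathfrak{M}_M(x,y)=\sum_{A\subseteq M}\mathfrak{M}_{M|_A}(0,y)\,T_{M/A}(x,0)=\sum_{A\subseteq M}T_{M|_A}(0,y)\,\mathfrak{M}_{M/A}(x,0). \]
   Context: A ranked set with multiplicities is a triple $(M,\operatorname{rk},m)$ where $M$ is a finite set, $\operatorname{rk}:2^M\to\mathbb{Z}$ is any function with $\operatorname{rk}(\emptyset)=0$, and $m:2^M\to R$ is any function. For $A\subseteq M$, the restriction $M|_A$ is $(A,\operatorname{rk}|_{2^A},m|_{2^A})$, and the contraction $M/A$ is $(M\setminus A,\operatorname{rk}_{M/A},m_{M/A})$ with $\operatorname{rk}_{M/A}(B)=\operatorname{rk}(B\cup A)-\operatorname{rk}(A)$ and $m_{M/A}(B)=m(B\cup A)$ for $B\subseteq M\setminus A$. Write $\operatorname{rk}(M)$ for the rank of the whole ground set. The arithmetic Tutte function is $\mathfrak{M}_M(x,y)=\sum_{A\subseteq M}m(A)(x-1)^{\operatorname{rk}(M)-\operatorname{rk}(A)}(y-1)^{|A|-\operatorname{rk}(A)}\in R(x,y)$ and the Tutte function is $T_M(x,y)=\sum_{A\subseteq M}(x-1)^{\operatorname{rk}(M)-\operatorname{rk}(A)}(y-1)^{|A|-\operatorname{rk}(A)}\in R(x,y)$ (exponents may be negative). Substituting $x=0$ (resp. $y=0$) replaces $(x-1)^k$ by $(-1)^k$ (resp. $(y-1)^k$ by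 $(-1)^k$). -}

module Defs where

open import Algebra.Bundles using (CommutativeRing)
open import Data.Nat using (ℕ; zero; suc)
open import Data.Integer as ℤ using (ℤ; +_; -[1+_])
open import Data.Fin.Subset using (Subset; inside; outside; _∪_; ∣_∣)
open import Data.Vec using ([]; _∷_)
open import Data.List using (List; []; _∷_; map; _++_)
open import Data.List as L using (foldr)

subsetsOf : ∀ {n} → Subset n → List (Subset n)
subsetsOf []            = [] ∷ []
subsetsOf (outside ∷ G) = map (outside ∷_) (subsetsOf G)
subsetsOf (inside ∷ G)  = map (outside ∷_) (subsetsOf G) ++ map (inside ∷_) (subsetsOf G)

contractRk : ∀ {n} → (Subset n → ℤ) → Subset n → Subset n → ℤ
contractRk rk A B = rk (B ∪ A) ℤ.- rk A

contractM : ∀ {n} {a} {C : Set a} → (Subset n → C) → Subset n → Subset n → C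
contractM m A B = m (B ∪ A)

module Tutte {c ℓ} (S : CommutativeRing c ℓ) where
  open CommutativeRing S

  Σ⊆ : ∀ {n} → Subset n → (Subset n → Carrier) → Carrier
  Σ⊆ G f = foldr _+_ 0# (map f (subsetsOf G))

  _^ⁿ_ : Carrier → ℕ → Carrier
  b ^ⁿ zero  = 1#
  b ^ⁿ suc k = b * (b ^ⁿ k)

  -- integer power of b, where bi is (meant to be) the inverse of b
  powℤ : Carrier → Carrier → ℤ → Carrier
  powℤ b bi (+ k)      = b ^ⁿ k
  powℤ b bi -[1+ k ]   = bi ^ⁿ suc k

  -- Arithmetic Tutte function of the ranked set with multiplicities on
  -- ground set G ⊆ Fin n (rank rk, multiplicity m), evaluated at x, y;
  -- xi, yi are the inverses of (x - 1), (y - 1) (used for negative exponents).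
  𝔐 : ∀ {n} → Subset n → (Subset n → ℤ) → (Subset n → Carrier)
      → Carrier → Carrier → Carrier → Carrier → Carrier
  𝔐 G rk m x xi y yi =
    Σ⊆ G (λ A → m A * powℤ (x - 1#) xi (rk G ℤ.- rk A)
                    * powℤ (y - 1#) yi ((+ ∣ A ∣) ℤ.- rk A))

  T : ∀ {n} → Subset n → (Subset n → ℤ)
      → Carrier → Carrier → Carrier → Carrier → Carrier
  T G rk x xi y yi =
    Σ⊆ G (λ A → powℤ (x - 1#) xi (rk G ℤ.- rk A)
                * powℤ (y - 1#) yi ((+ ∣ A ∣) ℤ.- rk A))

module Submission where

open import Defs
open import Algebra.Bundles using (CommutativeRing)
open import Data.Nat using (ℕ)
open import Data.Integer using (ℤ; +_)
open import Data.Fin.Subset using (Subset; ⊤; ⊥; _─_)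
open import Data.Product using (_×_)
open import Relation.Binary.PropositionalEquality using (_≡_)

open import Data.Product using (_,_)
open import Data.Nat using (zero; suc)
open import Data.Integer as ℤ using (-[1+_])
import Data.Integer.Properties as ℤ
open import Data.Integer.Tactic.RingSolver using () renaming (solve-∀ to ℤ-solve-∀)
open import Data.Fin.Subset using (inside; outside; _∪_; ∣_∣)
open import Data.Vec using ([]; _∷_)
open import Data.List using (List; []; _∷_; map; _++_; foldr)
open import Data.Maybe using (nothing)
import Relation.Binary.PropositionalEquality as P
open import Tactic.RingSolver.Core.AlmostCommutativeRing
  using (AlmostCommutativeRing; fromCommutativeRing)
open import Tactic.RingSolver using (solve-∀)

-- Write X(D) = (x-1)^{rk M - rk D}, Y(D) = (y-1)^{|D| - rk D} and
-- σ(k) = (-1)^k.  Multiplying out either right-hand side gives a sum over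
-- A ⊆ M, B ⊆ A and C ⊆ M ∖ A; with D = C ∪ A the summand carries the signs
--   σ(rk A - rk B) · σ(|C| - (rk D - rk A)) = (-1)^{|C|} · σ(rk D - rk B),
-- because σ is a homomorphism ℤ → R that is trivial on even integers.
-- So both formulas are instances of the alternating-sum identity
--   Σ_A Σ_{B ⊆ A} Σ_{C ⊆ M∖A} (-1)^{|C|} g(B, C ∪ A) = Σ_D g(D, D)
-- (for fixed B ⊆ D, Σ_{B ⊆ A ⊆ D} (-1)^{|D∖A|} vanishes unless B = D),
-- proved by induction on the size of the ground set.

complement-∪ : ∀ {n} (A : Subset n) → (⊤ ─ A) ∪ A ≡ ⊤
complement-∪ []            = P.refl
complement-∪ (outside ∷ A) = P.cong (inside ∷_) (complement-∪ A)
complement-∪ (inside ∷ A)  = P.cong (inside ∷_) (complement-∪ A)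

contract-corank : ∀ {n} (rk : Subset n → ℤ) (A C : Subset n) →
  contractRk rk A (⊤ ─ A) ℤ.- contractRk rk A C ≡ rk ⊤ ℤ.- rk (C ∪ A)
contract-corank rk A C = begin
  (rk ((⊤ ─ A) ∪ A) ℤ.- rk A) ℤ.- (rk (C ∪ A) ℤ.- rk A)
    ≡⟨ P.cong (λ G → (rk G ℤ.- rk A) ℤ.- (rk (C ∪ A) ℤ.- rk A)) (complement-∪ A) ⟩
  (rk ⊤ ℤ.- rk A) ℤ.- (rk (C ∪ A) ℤ.- rk A)
    ≡⟨ cancel (rk ⊤) (rk A) (rk (C ∪ A)) ⟩
  rk ⊤ ℤ.- rk (C ∪ A) ∎
  where
  open P.≡-Reasoning
  cancel : ∀ p q r → (p ℤ.- q) ℤ.- (r ℤ.- q) ≡ p ℤ.- r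
  cancel = ℤ-solve-∀

module ArithmeticTutte {c ℓ} (S : CommutativeRing c ℓ) where
  module Identities where
    R : AlmostCommutativeRing c ℓ
    R = fromCommutativeRing S (λ _ → nothing)
    open AlmostCommutativeRing R

    interchange : ∀ a b c d → (a + b) + (c + d) ≈ (a + c) + (b + d)
    interchange = solve-∀ R

    regroup-outer : ∀ a b c d → (a + b) + (c + d) ≈ (a + d) + (b + c)
    regroup-outer = solve-∀ R

    pair-products : ∀ p s q t → (p * s) * (q * t) ≈ (p * q) * (s * t)
    pair-products = solve-∀ R

    pull-left : ∀ p e s → p * (e * s) ≈ e * (p * s)
    pull-left = solve-∀ R

  open CommutativeRing S
  open Tutte S
  open import Relation.Binary.Reasoning.Setoid setoid

  open Identities
  open import Algebra.Properties.Ring ring using (-1*x≈-x; -‿involutive)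

  swap-last : ∀ a b c → (a * b) * c ≈ (a * c) * b
  swap-last a b c = trans (*-assoc a b c) (trans (*-cong refl (*-comm b c)) (sym (*-assoc a c b)))

  sumOver : ∀ {a} {I : Set a} → List I → (I → Carrier) → Carrier
  sumOver xs f = foldr _+_ 0# (map f xs)

  sum-cong : ∀ {a} {I : Set a} (xs : List I) {f g : I → Carrier} →
             (∀ i → f i ≈ g i) → sumOver xs f ≈ sumOver xs g
  sum-cong []       f≈g = refl
  sum-cong (x ∷ xs) f≈g = +-cong (f≈g x) (sum-cong xs f≈g)

  sum-++ : ∀ {a} {I : Set a} (xs ys : List I) f →
           sumOver (xs ++ ys) f ≈ sumOver xs f + sumOver ys f
  sum-++ []       ys f = sym (+-identityˡ _)
  sum-++ (x ∷ xs) ys f = trans (+-cong refl (sum-++ xs ys f)) (sym (+-assoc _ _ _))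

  sum-map : ∀ {a b} {I : Set a} {J : Set b} (h : I → J) (xs : List I) f →
            sumOver (map h xs) f ≈ sumOver xs (λ i → f (h i))
  sum-map h []       f = refl
  sum-map h (x ∷ xs) f = +-cong refl (sum-map h xs f)

  sum-+ : ∀ {a} {I : Set a} (xs : List I) f g →
          sumOver xs (λ i → f i + g i) ≈ sumOver xs f + sumOver xs g
  sum-+ []       f g = sym (+-identityˡ 0#)
  sum-+ (x ∷ xs) f g = trans (+-cong refl (sum-+ xs f g)) (interchange _ _ _ _)

  sum-*ˡ : ∀ {a} {I : Set a} (xs : List I) k f →
           k * sumOver xs f ≈ sumOver xs (λ i → k * f i)
  sum-*ˡ []       k f = zeroʳ k
  sum-*ˡ (x ∷ xs) k f = trans (distribˡ k _ _) (+-cong refl (sum-*ˡ xs k f))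

  sum-*ʳ : ∀ {a} {I : Set a} (xs : List I) k f →
           sumOver xs f * k ≈ sumOver xs (λ i → f i * k)
  sum-*ʳ xs k f = trans (*-comm _ _) (trans (sum-*ˡ xs k f) (sum-cong xs (λ i → *-comm k (f i))))

  sum-product : ∀ {a b} {I : Set a} {J : Set b} (xs : List I) (ys : List J) f g →
                sumOver xs f * sumOver ys g ≈ sumOver xs (λ i → sumOver ys (λ j → f i * g j))
  sum-product xs ys f g = trans (sum-*ʳ xs _ f) (sum-cong xs (λ i → sum-*ˡ ys (f i) g))

  Σ⊆-outside : ∀ {n} (G : Subset n) f →
               Σ⊆ (outside ∷ G) f ≈ Σ⊆ G (λ B → f (outside ∷ B))
  Σ⊆-outside G f = sum-map (outside ∷_) (subsetsOf G) f

  Σ⊆-inside : ∀ {n} (G : Subset n) f →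
              Σ⊆ (inside ∷ G) f ≈ Σ⊆ G (λ B → f (outside ∷ B)) + Σ⊆ G (λ B → f (inside ∷ B))
  Σ⊆-inside {n} G f = trans (sum-++ (map (outside ∷_) Gs) (map (inside ∷_) Gs) f)
                        (+-cong (sum-map (outside ∷_) Gs f) (sum-map (inside ∷_) Gs f))
    where
    Gs : List (Subset n)
    Gs = subsetsOf G

  ^ⁿ-cong : ∀ {a b} → a ≈ b → ∀ k → a ^ⁿ k ≈ b ^ⁿ k
  ^ⁿ-cong a≈b zero    = refl
  ^ⁿ-cong a≈b (suc k) = *-cong a≈b (^ⁿ-cong a≈b k)

  module UnitPowers (b bi : Carrier) (b*bi≈1 : b * bi ≈ 1#) where
    b*[bi*z] : ∀ z → b * (bi * z) ≈ z
    b*[bi*z] z = trans (sym (*-assoc b bi z)) (trans (*-cong b*bi≈1 refl) (*-identityˡ z))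

    bi*[b*z] : ∀ z → bi * (b * z) ≈ z
    bi*[b*z] z = trans (sym (*-assoc bi b z))
                       (trans (*-cong (trans (*-comm bi b) b*bi≈1) refl) (*-identityˡ z))

    powℤ-suc : ∀ k → powℤ b bi (ℤ.suc k) ≈ b * powℤ b bi k
    powℤ-suc (+ k)          = refl
    powℤ-suc -[1+ zero ]    = sym (b*[bi*z] 1#)
    powℤ-suc -[1+ suc k ]   = sym (b*[bi*z] _)

    powℤ-pred : ∀ k → powℤ b bi (ℤ.pred k) ≈ bi * powℤ b bi k
    powℤ-pred (+ zero)      = refl
    powℤ-pred (+ suc k)     = sym (bi*[b*z] _)
    powℤ-pred -[1+ k ]      = refl

    powℤ-+ : ∀ k l → powℤ b bi (k ℤ.+ l) ≈ powℤ b bi k * powℤ b bi l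
    powℤ-+ (+ zero) l = trans (reflexive (P.cong (powℤ b bi) (ℤ.+-identityˡ l))) (sym (*-identityˡ _))
    powℤ-+ (+ suc k) l = begin
      powℤ b bi (+ suc k ℤ.+ l)         ≡⟨ P.cong (powℤ b bi) (ℤ.+-assoc (+ 1) (+ k) l) ⟩
      powℤ b bi (ℤ.suc (+ k ℤ.+ l))     ≈⟨ powℤ-suc (+ k ℤ.+ l) ⟩
      b * powℤ b bi (+ k ℤ.+ l)         ≈⟨ *-cong refl (powℤ-+ (+ k) l) ⟩
      b * (powℤ b bi (+ k) * powℤ b bi l) ≈⟨ sym (*-assoc _ _ _) ⟩
      powℤ b bi (+ suc k) * powℤ b bi l ∎
    powℤ-+ -[1+ zero ] l = trans (powℤ-pred l) (*-cong (sym (*-identityʳ bi)) refl)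
    powℤ-+ -[1+ suc k ] l = begin
      powℤ b bi (-[1+ suc k ] ℤ.+ l)          ≡⟨ P.cong (powℤ b bi) (ℤ.+-assoc -[1+ 0 ] -[1+ k ] l) ⟩
      powℤ b bi (ℤ.pred (-[1+ k ] ℤ.+ l))     ≈⟨ powℤ-pred (-[1+ k ] ℤ.+ l) ⟩
      bi * powℤ b bi (-[1+ k ] ℤ.+ l)         ≈⟨ *-cong refl (powℤ-+ -[1+ k ] l) ⟩
      bi * (powℤ b bi -[1+ k ] * powℤ b bi l) ≈⟨ sym (*-assoc _ _ _) ⟩
      powℤ b bi -[1+ suc k ] * powℤ b bi l ∎

  -- The value of x - 1 at x = 0, and the sign σ k = (-1)^k it produces
  -- (its inverse is -1, as used by the evaluations at x = 0 and y = 0).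
  e : Carrier
  e = 0# - 1#

  σ : ℤ → Carrier
  σ = powℤ e (- 1#)

  e≈-1 : e ≈ - 1#
  e≈-1 = +-identityˡ (- 1#)

  e*z≈-z : ∀ z → e * z ≈ - z
  e*z≈-z z = trans (*-cong e≈-1 refl) (-1*x≈-x z)

  e*-1≈1 : e * (- 1#) ≈ 1#
  e*-1≈1 = trans (e*z≈-z (- 1#)) (-‿involutive 1#)

  open UnitPowers e (- 1#) e*-1≈1 using () renaming (powℤ-+ to σ-+)

  -- σ(-k) = σ(k): the inverse of e = -1 is -1 itself.
  σ-neg : ∀ k → σ (ℤ.- k) ≈ σ k
  σ-neg (+ zero)    = refl
  σ-neg (+ suc k)   = sym (^ⁿ-cong e≈-1 (suc k))
  σ-neg -[1+ k ]    = ^ⁿ-cong e≈-1 (suc k)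

  σ-even : ∀ t → σ (t ℤ.+ t) ≈ 1#
  σ-even t = begin
    σ (t ℤ.+ t)         ≈⟨ σ-+ t t ⟩
    σ t * σ t           ≈⟨ *-cong refl (sym (σ-neg t)) ⟩
    σ t * σ (ℤ.- t)     ≈⟨ sym (σ-+ t (ℤ.- t)) ⟩
    σ (t ℤ.+ ℤ.- t)     ≡⟨ P.cong σ (ℤ.+-inverseʳ t) ⟩
    1#                  ∎

  -- The sign bookkeeping of the whole proof: with a = rk A, b = rk B,
  -- d = rk (C ∪ A) and k = |C|,
  --   σ(a - b) σ(k - (d - a)) = (-1)^k σ(d - b).
  σ-chain : ∀ a b d k → σ (a ℤ.- b) * σ (+ k ℤ.- (d ℤ.- a)) ≈ e ^ⁿ k * σ (d ℤ.- b)
  σ-chain a b d k = begin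
    σ (a ℤ.- b) * σ (+ k ℤ.- (d ℤ.- a))                  ≈⟨ sym (σ-+ (a ℤ.- b) _) ⟩
    σ ((a ℤ.- b) ℤ.+ (+ k ℤ.- (d ℤ.- a)))                 ≡⟨ P.cong σ (regroup a b d (+ k)) ⟩
    σ ((+ k ℤ.+ (d ℤ.- b)) ℤ.+ ((a ℤ.- d) ℤ.+ (a ℤ.- d))) ≈⟨ σ-+ (+ k ℤ.+ (d ℤ.- b)) _ ⟩
    σ (+ k ℤ.+ (d ℤ.- b)) * σ ((a ℤ.- d) ℤ.+ (a ℤ.- d))   ≈⟨ *-cong refl (σ-even (a ℤ.- d)) ⟩
    σ (+ k ℤ.+ (d ℤ.- b)) * 1#                            ≈⟨ *-identityʳ _ ⟩
    σ (+ k ℤ.+ (d ℤ.- b))                                 ≈⟨ σ-+ (+ k) (d ℤ.- b) ⟩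
    e ^ⁿ k * σ (d ℤ.- b)                                  ∎
    where
    regroup : ∀ a b d k → (a ℤ.- b) ℤ.+ (k ℤ.- (d ℤ.- a))
                        ≡ (k ℤ.+ (d ℤ.- b)) ℤ.+ ((a ℤ.- d) ℤ.+ (a ℤ.- d))
    regroup = ℤ-solve-∀

  -- σ(0) = 1, in the form in which it occurs on the diagonal B = D.
  σ-diagonal : ∀ a → σ (a ℤ.- a) ≈ 1#
  σ-diagonal a = reflexive (P.cong σ (ℤ.+-inverseʳ a))

  alternating-cancel : ∀ a b c → (a + e * b) + (b + c) ≈ a + c
  alternating-cancel a b c = begin
    (a + e * b) + (b + c)   ≈⟨ regroup-outer a _ b c ⟩
    (a + c) + (e * b + b)   ≈⟨ +-cong refl (trans (+-cong (e*z≈-z b) refl) (-‿inverseˡ b)) ⟩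
    (a + c) + 0#            ≈⟨ +-identityʳ _ ⟩
    a + c                   ∎

  alternatingSum : ∀ {n} → (Subset n → Subset n → Carrier) → Subset n → Carrier
  alternatingSum g A = Σ⊆ A (λ B → Σ⊆ (⊤ ─ A) (λ C → e ^ⁿ ∣ C ∣ * g B (C ∪ A)))

  -- Induction on n: splitting off the first point, the terms where it lies
  -- in D but not in B appear twice with opposite signs and cancel.
  alternating-sum-diagonal : ∀ n (g : Subset n → Subset n → Carrier) →
    Σ⊆ ⊤ (alternatingSum g) ≈ Σ⊆ ⊤ (λ D → g D D)
  alternating-sum-diagonal zero    g = +-cong (trans (+-identityʳ _) (trans (+-identityʳ _) (*-identityˡ _))) refl
  alternating-sum-diagonal (suc n) g = begin
    Σ⊆ ⊤ (alternatingSum g)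
      ≈⟨ Σ⊆-inside ⊤ (alternatingSum g) ⟩
    Σ⊆ ⊤ (λ A → alternatingSum g (outside ∷ A)) + Σ⊆ ⊤ (λ A → alternatingSum g (inside ∷ A))
      ≈⟨ +-cong (sum-cong (subsetsOf ⊤) first-point-outside) (sum-cong (subsetsOf ⊤) first-point-inside) ⟩
    Σ⊆ ⊤ (λ A → alt₀₀ A + e * alt₀₁ A) + Σ⊆ ⊤ (λ A → alt₀₁ A + alt₁₁ A)
      ≈⟨ +-cong (trans (sum-+ (subsetsOf ⊤) alt₀₀ _) (+-cong refl (sym (sum-*ˡ (subsetsOf ⊤) e alt₀₁))))
                (sum-+ (subsetsOf ⊤) alt₀₁ alt₁₁) ⟩
    (Σ⊆ ⊤ alt₀₀ + e * Σ⊆ ⊤ alt₀₁) + (Σ⊆ ⊤ alt₀₁ + Σ⊆ ⊤ alt₁₁)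
      ≈⟨ alternating-cancel _ _ _ ⟩
    Σ⊆ ⊤ alt₀₀ + Σ⊆ ⊤ alt₁₁
      ≈⟨ +-cong (alternating-sum-diagonal n g₀₀) (alternating-sum-diagonal n g₁₁) ⟩
    Σ⊆ ⊤ (λ D → g (outside ∷ D) (outside ∷ D)) + Σ⊆ ⊤ (λ D → g (inside ∷ D) (inside ∷ D))
      ≈⟨ sym (Σ⊆-inside ⊤ (λ D → g D D)) ⟩
    Σ⊆ ⊤ (λ D → g D D) ∎
    where
    g₀₀ g₀₁ g₁₁ : Subset n → Subset n → Carrier
    g₀₀ B D = g (outside ∷ B) (outside ∷ D)
    g₀₁ B D = g (outside ∷ B) (inside ∷ D)
    g₁₁ B D = g (inside ∷ B) (inside ∷ D)

    alt₀₀ alt₀₁ alt₁₁ : Subset n → Carrier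
    alt₀₀ = alternatingSum g₀₀
    alt₀₁ = alternatingSum g₀₁
    alt₁₁ = alternatingSum g₁₁

    -- If the first point is not in A, then C may or may not contain it;
    -- containing it contributes an extra sign e.
    first-point-outside : ∀ A → alternatingSum g (outside ∷ A) ≈ alt₀₀ A + e * alt₀₁ A
    first-point-outside A = begin
      alternatingSum g (outside ∷ A)
        ≈⟨ Σ⊆-outside A _ ⟩
      Σ⊆ A (λ B → Σ⊆ (inside ∷ (⊤ ─ A)) (λ C → e ^ⁿ ∣ C ∣ * g (outside ∷ B) (C ∪ (outside ∷ A))))
        ≈⟨ sum-cong (subsetsOf A) (λ B → Σ⊆-inside (⊤ ─ A) _) ⟩
      Σ⊆ A (λ B → Σ⊆ (⊤ ─ A) (λ C → e ^ⁿ ∣ C ∣ * g₀₀ B (C ∪ A))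
                + Σ⊆ (⊤ ─ A) (λ C → e * (e ^ⁿ ∣ C ∣) * g₀₁ B (C ∪ A)))
        ≈⟨ sum-cong (subsetsOf A) (λ B → +-cong refl
             (trans (sum-cong (subsetsOf (⊤ ─ A)) (λ C → *-assoc _ _ _)) (sym (sum-*ˡ (subsetsOf (⊤ ─ A)) e _)))) ⟩
      Σ⊆ A (λ B → Σ⊆ (⊤ ─ A) (λ C → e ^ⁿ ∣ C ∣ * g₀₀ B (C ∪ A))
                + e * Σ⊆ (⊤ ─ A) (λ C → e ^ⁿ ∣ C ∣ * g₀₁ B (C ∪ A)))
        ≈⟨ trans (sum-+ (subsetsOf A) _ _) (+-cong refl (sym (sum-*ˡ (subsetsOf A) e _))) ⟩
      alt₀₀ A + e * alt₀₁ A ∎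

    -- If the first point is in A, it lies in D = C ∪ A but not in C.
    first-point-inside : ∀ A → alternatingSum g (inside ∷ A) ≈ alt₀₁ A + alt₁₁ A
    first-point-inside A = trans (Σ⊆-inside A _)
      (+-cong (sum-cong (subsetsOf A) (λ B → Σ⊆-outside (⊤ ─ A) _))
              (sum-cong (subsetsOf A) (λ B → Σ⊆-outside (⊤ ─ A) _)))

  convolution : ∀ {n} (rk : Subset n → ℤ) (p q : Subset n → Carrier) →
    Σ⊆ ⊤ (λ A → Σ⊆ A (λ B → p B * σ (rk A ℤ.- rk B))
              * Σ⊆ (⊤ ─ A) (λ C → q (C ∪ A) * σ (+ ∣ C ∣ ℤ.- contractRk rk A C)))
    ≈ Σ⊆ ⊤ (λ D → p D * q D)
  convolution {n} rk p q = begin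
    Σ⊆ ⊤ (λ A → Σ⊆ A (λ B → p B * σ (rk A ℤ.- rk B))
              * Σ⊆ (⊤ ─ A) (λ C → q (C ∪ A) * σ (+ ∣ C ∣ ℤ.- contractRk rk A C)))
      ≈⟨ sum-cong (subsetsOf ⊤) (λ A → trans (sum-product (subsetsOf A) (subsetsOf (⊤ ─ A)) _ _)
           (sum-cong (subsetsOf A) (λ B → sum-cong (subsetsOf (⊤ ─ A)) (term A B)))) ⟩
    Σ⊆ ⊤ (alternatingSum g)
      ≈⟨ alternating-sum-diagonal n g ⟩
    Σ⊆ ⊤ (λ D → g D D)
      ≈⟨ sum-cong (subsetsOf ⊤) (λ D → trans (*-cong refl (σ-diagonal (rk D))) (*-identityʳ _)) ⟩
    Σ⊆ ⊤ (λ D → p D * q D) ∎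
    where
    g : Subset n → Subset n → Carrier
    g B D = (p B * q D) * σ (rk D ℤ.- rk B)

    term : ∀ A B C → (p B * σ (rk A ℤ.- rk B)) * (q (C ∪ A) * σ (+ ∣ C ∣ ℤ.- contractRk rk A C))
                   ≈ e ^ⁿ ∣ C ∣ * g B (C ∪ A)
    term A B C = begin
      (p B * σ (rk A ℤ.- rk B)) * (q (C ∪ A) * σ (+ ∣ C ∣ ℤ.- contractRk rk A C))
        ≈⟨ pair-products _ _ _ _ ⟩
      (p B * q (C ∪ A)) * (σ (rk A ℤ.- rk B) * σ (+ ∣ C ∣ ℤ.- contractRk rk A C))
        ≈⟨ *-cong refl (σ-chain (rk A) (rk B) (rk (C ∪ A)) ∣ C ∣) ⟩
      (p B * q (C ∪ A)) * (e ^ⁿ ∣ C ∣ * σ (rk (C ∪ A) ℤ.- rk B))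
        ≈⟨ pull-left _ _ _ ⟩
      e ^ⁿ ∣ C ∣ * g B (C ∪ A) ∎

  module Formulas {n} (rk : Subset n → ℤ) (m : Subset n → Carrier) (x xi y yi : Carrier) where
    X Y : Subset n → Carrier
    X D = powℤ (x - 1#) xi (rk ⊤ ℤ.- rk D)
    Y D = powℤ (y - 1#) yi (+ ∣ D ∣ ℤ.- rk D)

    𝔐-restriction : ∀ A → 𝔐 A rk m 0# (- 1#) y yi ≈ Σ⊆ A (λ B → (m B * Y B) * σ (rk A ℤ.- rk B))
    𝔐-restriction A = sum-cong (subsetsOf A) (λ B → swap-last (m B) _ (Y B))

    T-restriction : ∀ A → T A rk 0# (- 1#) y yi ≈ Σ⊆ A (λ B → Y B * σ (rk A ℤ.- rk B))
    T-restriction A = sum-cong (subsetsOf A) (λ B → *-comm _ (Y B))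

    X-contraction : ∀ A C → powℤ (x - 1#) xi (contractRk rk A (⊤ ─ A) ℤ.- contractRk rk A C) ≈ X (C ∪ A)
    X-contraction A C = reflexive (P.cong (powℤ (x - 1#) xi) (contract-corank rk A C))

    T-contraction : ∀ A → T (⊤ ─ A) (contractRk rk A) x xi 0# (- 1#)
                        ≈ Σ⊆ (⊤ ─ A) (λ C → X (C ∪ A) * σ (+ ∣ C ∣ ℤ.- contractRk rk A C))
    T-contraction A = sum-cong (subsetsOf (⊤ ─ A)) (λ C → *-cong (X-contraction A C) refl)

    𝔐-contraction : ∀ A → 𝔐 (⊤ ─ A) (contractRk rk A) (contractM m A) x xi 0# (- 1#)
                        ≈ Σ⊆ (⊤ ─ A) (λ C → (m (C ∪ A) * X (C ∪ A)) * σ (+ ∣ C ∣ ℤ.- contractRk rk A C))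
    𝔐-contraction A = sum-cong (subsetsOf (⊤ ─ A)) (λ C → *-cong (*-cong refl (X-contraction A C)) refl)

    first-formula : 𝔐 ⊤ rk m x xi y yi
                  ≈ Σ⊆ ⊤ (λ A → 𝔐 A rk m 0# (- 1#) y yi * T (⊤ ─ A) (contractRk rk A) x xi 0# (- 1#))
    first-formula = begin
      𝔐 ⊤ rk m x xi y yi
        ≈⟨ sum-cong (subsetsOf ⊤) (λ D → swap-last (m D) (X D) (Y D)) ⟩
      Σ⊆ ⊤ (λ D → (m D * Y D) * X D)
        ≈⟨ sym (convolution rk (λ B → m B * Y B) X) ⟩
      Σ⊆ ⊤ (λ A → Σ⊆ A (λ B → (m B * Y B) * σ (rk A ℤ.- rk B))
                * Σ⊆ (⊤ ─ A) (λ C → X (C ∪ A) * σ (+ ∣ C ∣ ℤ.- contractRk rk A C)))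
        ≈⟨ sum-cong (subsetsOf ⊤) (λ A → sym (*-cong (𝔐-restriction A) (T-contraction A))) ⟩
      Σ⊆ ⊤ (λ A → 𝔐 A rk m 0# (- 1#) y yi * T (⊤ ─ A) (contractRk rk A) x xi 0# (- 1#)) ∎

    second-formula : 𝔐 ⊤ rk m x xi y yi
                   ≈ Σ⊆ ⊤ (λ A → T A rk 0# (- 1#) y yi * 𝔐 (⊤ ─ A) (contractRk rk A) (contractM m A) x xi 0# (- 1#))
    second-formula = begin
      𝔐 ⊤ rk m x xi y yi
        ≈⟨ sum-cong (subsetsOf ⊤) (λ D → *-comm _ (Y D)) ⟩
      Σ⊆ ⊤ (λ D → Y D * (m D * X D))
        ≈⟨ sym (convolution rk Y (λ D → m D * X D)) ⟩
      Σ⊆ ⊤ (λ A → Σ⊆ A (λ B → Y B * σ (rk A ℤ.- rk B))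
                * Σ⊆ (⊤ ─ A) (λ C → (m (C ∪ A) * X (C ∪ A)) * σ (+ ∣ C ∣ ℤ.- contractRk rk A C)))
        ≈⟨ sum-cong (subsetsOf ⊤) (λ A → sym (*-cong (T-restriction A) (𝔐-contraction A))) ⟩
      Σ⊆ ⊤ (λ A → T A rk 0# (- 1#) y yi * 𝔐 (⊤ ─ A) (contractRk rk A) (contractM m A) x xi 0# (- 1#)) ∎

-- Theorem 1.1.
theorem1p1 : ∀ {c ℓ} (S : CommutativeRing c ℓ) (n : ℕ)
    (rk : Subset n → ℤ) → rk ⊥ ≡ + 0 →
    (m : Subset n → CommutativeRing.Carrier S) →
    (x xi y yi : CommutativeRing.Carrier S) →
    CommutativeRing._≈_ S (CommutativeRing._*_ S (CommutativeRing._-_ S x (CommutativeRing.1# S)) xi) (CommutativeRing.1# S) →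
    CommutativeRing._≈_ S (CommutativeRing._*_ S (CommutativeRing._-_ S y (CommutativeRing.1# S)) yi) (CommutativeRing.1# S) →
    CommutativeRing._≈_ S (Tutte.𝔐 S ⊤ rk m x xi y yi)
      (Tutte.Σ⊆ S ⊤ (λ A → CommutativeRing._*_ S
        (Tutte.𝔐 S A rk m (CommutativeRing.0# S) (CommutativeRing.-_ S (CommutativeRing.1# S)) y yi)
        (Tutte.T S (⊤ ─ A) (contractRk rk A) x xi (CommutativeRing.0# S) (CommutativeRing.-_ S (CommutativeRing.1# S)))))
    ×
    CommutativeRing._≈_ S (Tutte.𝔐 S ⊤ rk m x xi y yi)
      (Tutte.Σ⊆ S ⊤ (λ A → CommutativeRing._*_ S
        (Tutte.T S A rk (CommutativeRing.0# S) (CommutativeRing.-_ S (CommutativeRing.1# S)) y yi)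
        (Tutte.𝔐 S (⊤ ─ A) (contractRk rk A) (contractM m A) x xi (CommutativeRing.0# S) (CommutativeRing.-_ S (CommutativeRing.1# S)))))
theorem1p1 S n rk _ m x xi y yi _ _ = first-formula , second-formula
  where open ArithmeticTutte.Formulas S rk m x xi y yi
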